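{- Every border of an HV-palindrome is a 2D palindrome.
   Context: A 2D word of size $(m,n)$ over a finite alphabet is an $m\times n$ array $w=[w_{i,j}]$; its rows and columns are 1D words. A 1D word is a palindrome if it equals its reversal. The reverse of $w$ is $w^R=[w_{m-i+1,\,n-j+1}]_{i,j}$ and $w$ is a 2D palindrome if $w=w^R$; $w$ is an HV-palindrome if each of its rows and columns is a 1D palindrome. A prefix of $w$ is a top-left sub-array $[w_{i,j}]_{1\le i\le a,\,1\le j\le b}$, and a suffix is a bottom-right sub-array $[w_{i,j}]_{m-a+1\le i\le m,\,n-b+1\le j\le n}$. A border of $w$ is a non-empty 2D word that is both a prefix and a suffix of $w$. -}

module Defs where

open import Data.Nat using (ℕ; _≤_; NonZero)
open import Data.Fin using (Fin; opposite; inject≤)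
open import Data.Product using (_×_; Σ; ∃)
open import Relation.Binary.PropositionalEquality using (_≡_)

Word2D : Set → ℕ → ℕ → Set
Word2D A m n = Fin m → Fin n → A

reverse2D : {A : Set} {m n : ℕ} → Word2D A m n → Word2D A m n
reverse2D w i j = w (opposite i) (opposite j)

Palindrome2D : {A : Set} {m n : ℕ} → Word2D A m n → Set
Palindrome2D w = ∀ i j → w i j ≡ reverse2D w i j

Palindrome1D : {A : Set} {n : ℕ} → (Fin n → A) → Set
Palindrome1D v = ∀ j → v j ≡ v (opposite j)

HVPalindrome : {A : Set} {m n : ℕ} → Word2D A m n → Set
HVPalindrome w = (∀ i → Palindrome1D (λ j → w i j))
               × (∀ j → Palindrome1D (λ i → w i j))

IsPrefix : {A : Set} {m n a b : ℕ} → a ≤ m → b ≤ n →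
           Word2D A a b → Word2D A m n → Set
IsPrefix a≤m b≤n u w = ∀ i j → u i j ≡ w (inject≤ i a≤m) (inject≤ j b≤n)

-- u is a suffix of w: bottom-right sub-array. The 0-based index
-- opposite (inject≤ (opposite i) a≤m) equals (m - a) + i.
IsSuffix : {A : Set} {m n a b : ℕ} → a ≤ m → b ≤ n →
           Word2D A a b → Word2D A m n → Set
IsSuffix a≤m b≤n u w =
  ∀ i j → u i j ≡ w (opposite (inject≤ (opposite i) a≤m))
                     (opposite (inject≤ (opposite j) b≤n))

IsBorder : {A : Set} {m n a b : ℕ} → Word2D A a b → Word2D A m n → Set
IsBorder {m = m} {n} {a} {b} u w =
  NonZero a × NonZero b ×
  Σ (a ≤ m) λ a≤m → Σ (b ≤ n) λ b≤n → IsPrefix a≤m b≤n u w × IsSuffix a≤m b≤n u w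

-- An HV-palindrome is already a 2D palindrome: reversing every row and then
-- every column is the 2D reversal. A border u of a 2D palindrome w sits at the
-- top-left corner of w and, read backwards, at the top-left corner of w^R = w,
-- so u and u^R agree entry by entry.
module Submission where

open import Defs
open import Data.Nat using (ℕ; _≤_)
open import Data.Fin using (Fin; opposite; inject≤)
open import Data.Fin.Properties using (opposite-involutive)
open import Data.Product using (_,_)
open import Relation.Binary.PropositionalEquality using (_≡_; sym; trans; cong₂; module ≡-Reasoning)

hvPalindrome⇒palindrome2D : {A : Set} {m n : ℕ} {w : Word2D A m n} →
                            HVPalindrome w → Palindrome2D w
hvPalindrome⇒palindrome2D (rows , cols) i j = trans (rows i j) (cols (opposite j) i)

isSuffix-reverse : {A : Set} {m n a b : ℕ} (a≤m : a ≤ m) (b≤n : b ≤ n)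
                   {u : Word2D A a b} (w : Word2D A m n) → IsSuffix a≤m b≤n u w →
                   ∀ i j → reverse2D u i j ≡ reverse2D w (inject≤ i a≤m) (inject≤ j b≤n)
isSuffix-reverse a≤m b≤n w suf i j = trans (suf (opposite i) (opposite j))
  (cong₂ (λ x y → w (opposite (inject≤ x a≤m)) (opposite (inject≤ y b≤n)))
         (opposite-involutive i) (opposite-involutive j))

border-palindrome2D : {A : Set} {m n a b : ℕ} {w : Word2D A m n} {u : Word2D A a b} →
                      Palindrome2D w → IsBorder u w → Palindrome2D u
border-palindrome2D {w = w} {u} pal (_ , _ , a≤m , b≤n , pre , suf) i j = begin
  u i j                                          ≡⟨ pre i j ⟩
  w (inject≤ i a≤m) (inject≤ j b≤n)             ≡⟨ pal (inject≤ i a≤m) (inject≤ j b≤n) ⟩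
  reverse2D w (inject≤ i a≤m) (inject≤ j b≤n)   ≡⟨ sym (isSuffix-reverse a≤m b≤n w suf i j) ⟩
  reverse2D u i j                                ∎
  where open ≡-Reasoning

corollary3p7 : {k m n a b : ℕ} (w : Word2D (Fin k) m n) (u : Word2D (Fin k) a b) →
               HVPalindrome w → IsBorder u w → Palindrome2D u
corollary3p7 w u hv border = border-palindrome2D (hvPalindrome⇒palindrome2D hv) border
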